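{- Let $\mathcal{P}$ be a profile of unrooted phylogenetic trees whose display graph $G(\mathcal{P})$ is connected. Let $F$ be any minimal separator of $LG(\mathcal{P})$ and let $u$ be any vertex of any input tree $T\in\mathcal{P}$. Then $\mathrm{Inc}(u)\not\subseteq F$.
   Context: A phylogenetic tree is an unrooted tree whose leaves are bijectively labelled by a finite label set; leaves are identified with labels. A profile is a finite collection $\mathcal{P}=\{T_1,\dots,T_k\}$ of phylogenetic trees with pairwise disjoint sets of internal vertices. The display graph $G(\mathcal{P})$ has vertex set $\bigcup_iV(T_i)$ and edge set $\bigcup_iE(T_i)$. $LG(\mathcal{P})$ is the line graph of $G(\mathcal{P})$: vertex set $E(G(\mathcal{P}))$, two vertices adjacent iff the edges share an endpoint. $\mathrm{Inc}(u)$ is the set of edges of $G(\mathcal{P})$ incident to $u$ (equivalently the vertices $e$ of $LG(\mathcal{P})$ with $u\in e$). In a graph $G$, for nonadjacent $a,b$, an $a$-$b$ separator is $U\subset V(G)$ with $a,b$ in different components of $G-U$; it is minimal if no proper subset is an $a$-$b$ separator; $U$ is a minimal separator if it is a minimal $a$-$b$ separator for some nonadjacent $a,b$. -}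

module Defs where

open import Data.Nat using (ℕ; _≤_)
open import Data.Fin using (Fin)
open import Data.List using (List; []; _∷_; _++_; [_]; length)
open import Data.List.Membership.Propositional using (_∈_)
open import Data.List.Relation.Unary.Unique.Propositional using (Unique)
open import Data.List.Relation.Unary.Linked using (Linked)
open import Data.Product using (Σ; ∃; _×_; _,_)
open import Data.Sum using (_⊎_)
open import Relation.Nullary using (¬_)
open import Relation.Binary.PropositionalEquality using (_≡_; _≢_)
open import Relation.Binary.Construct.Closure.ReflexiveTransitive using (Star)

-- The edge list is read as a set of UNORDERED
-- pairs: orientation and repetitions in the list are irrelevant, since
-- everything is expressed through the symmetric relation Adj.

record FinGraph (V : Set) : Set where
  field
    verts : List V
    edges : List (V × V)

open FinGraph public

Adj : {V : Set} → FinGraph V → V → V → Set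
Adj T a b = ((a , b) ∈ edges T) ⊎ ((b , a) ∈ edges T)

HasCycle : {V : Set} → FinGraph V → Set
HasCycle T = Σ _ λ x → Σ _ λ xs →
  Unique (x ∷ xs) × (2 ≤ length xs) × Linked (Adj T) (x ∷ xs ++ [ x ])

record IsTree {V : Set} (T : FinGraph V) : Set where
  field
    endpoints : ∀ a b → (a , b) ∈ edges T → (a ∈ verts T) × (b ∈ verts T)
    loopless  : ∀ a b → (a , b) ∈ edges T → a ≢ b
    connected : ∀ a b → a ∈ verts T → b ∈ verts T → Star (Adj T) a b
    acyclic   : ¬ HasCycle T

IsLeaf : {V : Set} → FinGraph V → V → Set
IsLeaf T v = (v ∈ verts T) × Σ _ λ w → Adj T v w × (∀ w' → Adj T v w' → w' ≡ w)

IsInternal : {V : Set} → FinGraph V → V → Set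
IsInternal T v = (v ∈ verts T) × ¬ IsLeaf T v

-- Leaves are identified with labels, so the label set of a tree T is its
-- leaf set and the labelling is the identity (trivially bijective); a
-- phylogenetic tree is therefore just a tree whose vertices live in the
-- common vertex type V (labels and internal vertices).

IsPhyloTree : {V : Set} → FinGraph V → Set
IsPhyloTree T = IsTree T

record IsProfile {V : Set} (k : ℕ) (P : Fin k → FinGraph V) : Set where
  field
    phylo            : ∀ i → IsPhyloTree (P i)
    internalDisjoint : ∀ i j v → i ≢ j → IsInternal (P i) v → ¬ IsInternal (P j) v
    internalNotLabel : ∀ i j v → IsInternal (P i) v → ¬ IsLeaf (P j) v

module Display {V : Set} {k : ℕ} (P : Fin k → FinGraph V) where

  VertG : V → Set
  VertG v = ∃ λ i → v ∈ verts (P i)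

  AdjG : V → V → Set
  AdjG a b = ∃ λ i → Adj (P i) a b

  ConnectedG : Set
  ConnectedG = ∀ a b → VertG a → VertG b → Star AdjG a b

  -- Line graph LG(P).  An edge {a,b} of G(P) is represented by either of
  -- the ordered pairs (a , b), (b , a); SameEdge identifies them.

  IsEdgeG : V × V → Set
  IsEdgeG (a , b) = AdjG a b

  SameEdge : V × V → V × V → Set
  SameEdge (a , b) (c , d) = ((a ≡ c) × (b ≡ d)) ⊎ ((a ≡ d) × (b ≡ c))

  ShareEnd : V × V → V × V → Set
  ShareEnd (a , b) (c , d) = (a ≡ c) ⊎ (a ≡ d) ⊎ (b ≡ c) ⊎ (b ≡ d)

  AdjLG : V × V → V × V → Set
  AdjLG e f = IsEdgeG e × IsEdgeG f × ¬ SameEdge e f × ShareEnd e f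

  -- sets of vertices of LG(P) = sets of edges of G(P), given by a
  -- predicate on ordered pairs; the edge (a , b) belongs to S iff S holds
  -- for one of its two representations (so membership is well defined).
  EdgeSet : Set₁
  EdgeSet = V → V → Set

  _∈E_ : V × V → EdgeSet → Set
  (a , b) ∈E S = S a b ⊎ S b a

  _⊆E_ : EdgeSet → EdgeSet → Set
  S ⊆E S' = ∀ e → e ∈E S → e ∈E S'

  Present : EdgeSet → V × V → Set
  Present U e = IsEdgeG e × ¬ (e ∈E U)

  SameComp : EdgeSet → V × V → V × V → Set
  SameComp U e f = Present U e ×
    Σ _ λ f' → Star (λ x y → AdjLG x y × Present U y) e f' × SameEdge f' f

  IsSeparator : EdgeSet → V × V → V × V → Set
  IsSeparator U e f =
    (∀ g → g ∈E U → IsEdgeG g) ×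
    Present U e × Present U f × ¬ SameComp U e f

  IsMinimalSeparatorFor : EdgeSet → V × V → V × V → Set₁
  IsMinimalSeparatorFor U e f =
    IsSeparator U e f ×
    (∀ U' → U' ⊆E U → (Σ _ λ g → (g ∈E U) × ¬ (g ∈E U')) → ¬ IsSeparator U' e f)

  IsMinimalSeparator : EdgeSet → Set₁
  IsMinimalSeparator U = Σ _ λ e → Σ _ λ f →
    IsEdgeG e × IsEdgeG f × ¬ AdjLG e f × IsMinimalSeparatorFor U e f

  IncSubset : V → EdgeSet → Set
  IncSubset u F = ∀ w → AdjG u w → (u , w) ∈E F

-- If Inc(u) ⊆ F, pick an edge g = uw of G(P) (it exists because G(P) is
-- connected) and remove g from F.  In LG(P) − F every neighbour of g is an
-- edge at w, since the edges at u all lie in F; so the neighbours of g in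
-- LG(P) − F form a clique, and putting g back cannot join two components.
-- Hence F ∖ {g} still separates the same pair, contradicting minimality.
module Submission where

open import Defs
open import Data.Nat using (ℕ)
open import Data.Fin using (Fin)
open import Data.List.Membership.Propositional using (_∈_)
open import Data.Product using (Σ; ∃; _×_; _,_; proj₁; proj₂)
open import Data.Sum using (_⊎_; inj₁; inj₂)
open import Relation.Nullary using (¬_; yes; no)
open import Relation.Nullary.Decidable using (¬¬-excluded-middle)
open import Relation.Nullary.Negation using (contradiction)
open import Relation.Binary.PropositionalEquality using (_≡_; refl; sym; trans)
open import Relation.Binary.Construct.Closure.ReflexiveTransitive
  using (Star; ε; _◅_; _◅◅_)

Star-successor : {A : Set} {R : A → A → Set} {x y z : A} →
  Star R x y → R y z → ∃ λ w → R x w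
Star-successor ε r = _ , r
Star-successor (r ◅ _) _ = _ , r

Star-¬¬-invariant : {A : Set} {R : A → A → Set} (I : A → Set) →
  (∀ {x y} → I x → R x y → ¬ ¬ I y) →
  ∀ {x y} → Star R x y → I x → ¬ ¬ I y
Star-¬¬-invariant I step ε i ¬i = ¬i i
Star-¬¬-invariant I step (r ◅ rs) i ¬i =
  step i r λ i′ → Star-¬¬-invariant I step rs i′ ¬i

module LineGraph {V : Set} {k : ℕ} (P : Fin k → FinGraph V) where
  open Display P

  private
    variable
      a b u w : V
      x y z g e f : V × V
      F : EdgeSet

  AdjG-sym : AdjG a b → AdjG b a
  AdjG-sym (i , inj₁ ab) = i , inj₂ ab
  AdjG-sym (i , inj₂ ba) = i , inj₁ ba

  AdjG⇒VertG : IsProfile k P → AdjG a b → VertG a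
  AdjG⇒VertG prof (i , inj₁ ab) = i , proj₁ (IsTree.endpoints (IsProfile.phylo prof i) _ _ ab)
  AdjG⇒VertG prof (i , inj₂ ba) = i , proj₂ (IsTree.endpoints (IsProfile.phylo prof i) _ _ ba)

  SameEdge-refl : SameEdge x x
  SameEdge-refl = inj₁ (refl , refl)

  SameEdge-swap : SameEdge (a , b) (b , a)
  SameEdge-swap = inj₂ (refl , refl)

  SameEdge-sym : SameEdge x y → SameEdge y x
  SameEdge-sym (inj₁ (refl , refl)) = inj₁ (refl , refl)
  SameEdge-sym (inj₂ (refl , refl)) = inj₂ (refl , refl)

  SameEdge-trans : SameEdge x y → SameEdge y z → SameEdge x z
  SameEdge-trans (inj₁ (refl , refl)) yz = yz
  SameEdge-trans (inj₂ (refl , refl)) (inj₁ (refl , refl)) = inj₂ (refl , refl)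
  SameEdge-trans (inj₂ (refl , refl)) (inj₂ (refl , refl)) = inj₁ (refl , refl)

  IsEdgeG-resp : SameEdge x y → IsEdgeG x → IsEdgeG y
  IsEdgeG-resp (inj₁ (refl , refl)) ex = ex
  IsEdgeG-resp (inj₂ (refl , refl)) ex = AdjG-sym ex

  ∈E-resp : SameEdge x y → x ∈E F → y ∈E F
  ∈E-resp (inj₁ (refl , refl)) x∈F = x∈F
  ∈E-resp (inj₂ (refl , refl)) (inj₁ x∈F) = inj₂ x∈F
  ∈E-resp (inj₂ (refl , refl)) (inj₂ x∈F) = inj₁ x∈F

  ShareEnd-sym : ShareEnd x y → ShareEnd y x
  ShareEnd-sym (inj₁ p) = inj₁ (sym p)
  ShareEnd-sym (inj₂ (inj₁ p)) = inj₂ (inj₂ (inj₁ (sym p)))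
  ShareEnd-sym (inj₂ (inj₂ (inj₁ p))) = inj₂ (inj₁ (sym p))
  ShareEnd-sym (inj₂ (inj₂ (inj₂ p))) = inj₂ (inj₂ (inj₂ (sym p)))

  ShareEnd-respˡ : SameEdge x y → ShareEnd x z → ShareEnd y z
  ShareEnd-respˡ (inj₁ (refl , refl)) s = s
  ShareEnd-respˡ (inj₂ (refl , refl)) (inj₁ p) = inj₂ (inj₂ (inj₁ p))
  ShareEnd-respˡ (inj₂ (refl , refl)) (inj₂ (inj₁ p)) = inj₂ (inj₂ (inj₂ p))
  ShareEnd-respˡ (inj₂ (refl , refl)) (inj₂ (inj₂ (inj₁ p))) = inj₁ p
  ShareEnd-respˡ (inj₂ (refl , refl)) (inj₂ (inj₂ (inj₂ p))) = inj₂ (inj₁ p)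

  AdjLG-respˡ : SameEdge x y → AdjLG x z → AdjLG y z
  AdjLG-respˡ xy (ex , ez , x≁z , s) =
    IsEdgeG-resp xy ex , ez , (λ yz → x≁z (SameEdge-trans xy yz)) , ShareEnd-respˡ xy s

  EndOf : V → V × V → Set
  EndOf v (a , b) = (v ≡ a) ⊎ (v ≡ b)

  ShareEnd-ends : ShareEnd (u , w) y → EndOf u y ⊎ EndOf w y
  ShareEnd-ends (inj₁ p) = inj₁ (inj₁ p)
  ShareEnd-ends (inj₂ (inj₁ p)) = inj₁ (inj₂ p)
  ShareEnd-ends (inj₂ (inj₂ (inj₁ p))) = inj₂ (inj₁ p)
  ShareEnd-ends (inj₂ (inj₂ (inj₂ p))) = inj₂ (inj₂ p)

  EndOf⇒ShareEnd : EndOf w x → EndOf w y → ShareEnd x y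
  EndOf⇒ShareEnd (inj₁ p) (inj₁ q) = inj₁ (trans (sym p) q)
  EndOf⇒ShareEnd (inj₁ p) (inj₂ q) = inj₂ (inj₁ (trans (sym p) q))
  EndOf⇒ShareEnd (inj₂ p) (inj₁ q) = inj₂ (inj₂ (inj₁ (trans (sym p) q)))
  EndOf⇒ShareEnd (inj₂ p) (inj₂ q) = inj₂ (inj₂ (inj₂ (trans (sym p) q)))

  IncSubset⇒∈E : IncSubset u F → IsEdgeG y → EndOf u y → y ∈E F
  IncSubset⇒∈E inc ey (inj₁ refl) = inc _ ey
  IncSubset⇒∈E {F = F} inc ey (inj₂ refl) = ∈E-resp {F = F} SameEdge-swap (inc _ (AdjG-sym ey))

  CliqueNeighbourhood : EdgeSet → V × V → Set
  CliqueNeighbourhood F g = ∀ x y → Present F x → Present F y →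
    ShareEnd g x → ShareEnd g y → ShareEnd x y

  IncSubset⇒CliqueNeighbourhood : IncSubset u F → CliqueNeighbourhood F (u , w)
  IncSubset⇒CliqueNeighbourhood {u = u} {F = F} {w = w} inc x y (ex , x∉F) (ey , y∉F) gx gy =
    EndOf⇒ShareEnd (endAt-w ex x∉F gx) (endAt-w ey y∉F gy)
    where
    endAt-w : IsEdgeG z → ¬ z ∈E F → ShareEnd (u , w) z → EndOf w z
    endAt-w ez z∉F gz with ShareEnd-ends gz
    ... | inj₁ at-u = contradiction (IncSubset⇒∈E inc ez at-u) z∉F
    ... | inj₂ at-w = at-w

  _∖E_ : EdgeSet → V × V → EdgeSet
  (F ∖E g) a b = F a b × ¬ SameEdge (a , b) g

  ∖E-⊆E : (F ∖E g) ⊆E F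
  ∖E-⊆E _ (inj₁ (ab∈F , _)) = inj₁ ab∈F
  ∖E-⊆E _ (inj₂ (ba∈F , _)) = inj₂ ba∈F

  ∉-∖E : ¬ g ∈E (F ∖E g)
  ∉-∖E (inj₁ (_ , g≁g)) = g≁g SameEdge-refl
  ∉-∖E (inj₂ (_ , g≁g)) = g≁g SameEdge-swap

  ∈-∖E : ¬ SameEdge y g → y ∈E F → y ∈E (F ∖E g)
  ∈-∖E y≁g (inj₁ ab∈F) = inj₁ (ab∈F , y≁g)
  ∈-∖E y≁g (inj₂ ba∈F) = inj₂ (ba∈F , λ ba≈g → y≁g (SameEdge-trans SameEdge-swap ba≈g))

  Present-∖E : Present F x → Present (F ∖E g) x
  Present-∖E {F = F} {g = g} (ex , x∉F) = ex , λ x∈F∖g → x∉F (∖E-⊆E {F = F} {g = g} _ x∈F∖g)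

  Present-∖E⁻ : ¬ SameEdge y g → Present (F ∖E g) y → Present F y
  Present-∖E⁻ {F = F} y≁g (ey , y∉F∖g) = ey , λ y∈F → y∉F∖g (∈-∖E {F = F} y≁g y∈F)

  Step : EdgeSet → V × V → V × V → Set
  Step U x y = AdjLG x y × Present U y

  Present-end : Present F x → Star (Step F) x y → Present F y
  Present-end px ε = px
  Present-end _ (s ◅ ss) = Present-end (proj₂ s) ss

  module Bypass (F : EdgeSet) (g : V × V) (clique : CliqueNeighbourhood F g)
                (e : V × V) (pe : Present F e) where

    Reached : V × V → Set
    Reached y = (Σ _ λ y′ → Star (Step F) e y′ × SameEdge y′ y)
              ⊎ (SameEdge y g × Σ _ λ x → Star (Step F) e x × ShareEnd g x)

    -- Equality of vertices is not decidable, so the invariant only survives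
    -- a step up to double negation.
    step : Reached x → Step (F ∖E g) x y → ¬ ¬ Reached y
    step {y = y} (inj₁ (x′ , path , x′≈x)) (adj , py) ¬r =
      ¬¬-excluded-middle {A = SameEdge y g} λ where
        (yes y≈g) → ¬r (inj₂ (y≈g , x′ , path , g-meets-x′ y≈g))
        (no y≁g) → ¬r (inj₁ (y , path ◅◅ ((x′-adj-y , Present-∖E⁻ {F = F} y≁g py) ◅ ε)
                             , SameEdge-refl))
      where
      x′-adj-y : AdjLG x′ y
      x′-adj-y = AdjLG-respˡ (SameEdge-sym x′≈x) adj
      g-meets-x′ : SameEdge y g → ShareEnd g x′
      g-meets-x′ y≈g = ShareEnd-respˡ y≈g (ShareEnd-sym (proj₂ (proj₂ (proj₂ x′-adj-y))))
    step {y = y} (inj₂ (x≈g , n , path , g-meets-n)) ((_ , ey , x≁y , x-meets-y) , py) ¬r =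
      ¬¬-excluded-middle {A = SameEdge n y} λ where
        (yes n≈y) → ¬r (inj₁ (n , path , n≈y))
        (no n≁y) → ¬r (inj₁ (y , path ◅◅ (((proj₁ pn , ey , n≁y , n-meets-y) , py′) ◅ ε)
                             , SameEdge-refl))
      where
      py′ : Present F y
      py′ = Present-∖E⁻ {F = F} (λ y≈g → x≁y (SameEdge-trans x≈g (SameEdge-sym y≈g))) py
      pn : Present F n
      pn = Present-end pe path
      n-meets-y : ShareEnd n y
      n-meets-y = clique _ _ pn py′ g-meets-n (ShareEnd-respˡ x≈g x-meets-y)

  ∖E-preserves-separator : g ∈E F → CliqueNeighbourhood F g →
    IsSeparator F e f → IsSeparator (F ∖E g) e f
  ∖E-preserves-separator {g = g} {F = F} {e = e} {f = f} g∈F clique (edges , pe , pf , ¬comp) =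
    (λ x x∈F∖g → edges x (∖E-⊆E {F = F} {g = g} x x∈F∖g)) ,
    Present-∖E {F = F} pe , Present-∖E {F = F} pf ,
    λ (_ , f′ , path , f′≈f) →
      Star-¬¬-invariant Reached step path (inj₁ (e , ε , SameEdge-refl)) (unreached f′≈f)
    where
    open Bypass F g clique e pe
    unreached : ∀ {f′} → SameEdge f′ f → ¬ Reached f′
    unreached f′≈f (inj₁ (f″ , path , f″≈f′)) = ¬comp (pe , f″ , path , SameEdge-trans f″≈f′ f′≈f)
    unreached f′≈f (inj₂ (f′≈g , _)) =
      proj₂ pf (∈E-resp {F = F} (SameEdge-trans (SameEdge-sym f′≈g) f′≈f) g∈F)

  minimal-separator-edge-not-clique : IsMinimalSeparatorFor F e f → g ∈E F →
    ¬ CliqueNeighbourhood F g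
  minimal-separator-edge-not-clique {F = F} {g = g} (sep , minimal) g∈F clique =
    minimal (F ∖E g) (∖E-⊆E {F = F} {g = g}) (g , g∈F , ∉-∖E {g = g} {F = F})
      (∖E-preserves-separator {F = F} g∈F clique sep)

lemma3 : {V : Set} (k : ℕ) (P : Fin k → FinGraph V) → IsProfile k P →
    Display.ConnectedG P →
    (F : Display.EdgeSet P) → Display.IsMinimalSeparator P F →
    (i : Fin k) (u : V) → u ∈ verts (P i) →
    ¬ Display.IncSubset P u F
lemma3 k P prof connected F ((a , b) , f , ab , _ , _ , minimal) i u u∈Tᵢ inc =
  minimal-separator-edge-not-clique {F = F} minimal (inc w uw)
    (IncSubset⇒CliqueNeighbourhood {F = F} inc)
  where
  open Display P
  open LineGraph P
  u-has-neighbour : ∃ λ w → AdjG u w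
  u-has-neighbour = Star-successor (connected u a (i , u∈Tᵢ) (AdjG⇒VertG prof ab)) ab
  w = proj₁ u-has-neighbour
  uw = proj₂ u-has-neighbour
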